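{- Let $a_1,a_2,\dots$ be a fixed sequence of positive integers, let $y=x+1$, and for $n\ge 2$ let $p_n(x,y)$ be as defined in the context. Then for every $n\ge 4$, $$p_n(x,y)=(-1)^{n+1}a_n\,p_{n-1}(x,y)+xy\,p_{n-2}(x,y).$$
   Context: For a positive integer $k$ and $1\le l\le k$, let $I_{k,l}$ be the set of strictly increasing sequences $(t_1,\dots,t_l)$ in $\{1,\dots,k\}$ with $t_i\equiv k+i-l\pmod 2$ for all $i$; set $\gamma_k(l)=\sum_{(t_1,\dots,t_l)\in I_{k,l}}a_{t_1}\cdots a_{t_l}$ for $1\le l\le k$ and $\gamma_k(0)=1$. For $n\ge 2$ write $n=2m+r_0$ with $r_0\in\{0,1\}$ and let $r_1\in\{0,1\}$ with $r_1\equiv r_0+1\pmod 2$. With $y=x+1$, define $$p_n(x,y)=x^{r_0}\sum_{k=0}^{m}(-1)^{m-k}x^ky^k\gamma_n(n-2k-r_0)+x^{r_1}\sum_{k=0}^{m-r_1}(-1)^{m-k}x^ky^k\gamma_n(n-2k-r_1).$$ -}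

module Defs where

open import Data.Bool using (Bool; true; false; _∧_)
open import Data.Nat as ℕ using (ℕ; zero; suc; _∸_; _≡ᵇ_; _%_; _/_)
open import Data.Integer as ℤ using (ℤ; _*_; _+_; -_; _^_)
open import Data.List using (List; []; _∷_; map; _++_; filterᵇ; upTo)
import Data.List as L
open import Function using (_∘_)

seqs : ℕ → ℕ → ℕ → List (List ℕ)
seqs lo zero    zero    = [] ∷ []
seqs lo zero    (suc l) = []
seqs lo (suc c) zero    = [] ∷ []
seqs lo (suc c) (suc l) = map (lo ∷_) (seqs (suc lo) c l) ++ seqs (suc lo) c (suc l)

parityOK : ℕ → ℕ → ℕ → List ℕ → Bool
parityOK k l i []       = true
parityOK k l i (t ∷ ts) = ((t % 2) ≡ᵇ (((k ℕ.+ i) ∸ l) % 2)) ∧ parityOK k l (suc i) ts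

I : ℕ → ℕ → List (List ℕ)
I k l = filterᵇ (parityOK k l 1) (seqs 1 k l)

sumℤ : List ℤ → ℤ
sumℤ = L.foldr _+_ (ℤ.+ 0)

prodℤ : List ℤ → ℤ
prodℤ = L.foldr _*_ (ℤ.+ 1)

-- γ_k(l) for the sequence a (a 0 is unused; the paper's a_1, a_2, ...).
γ : (ℕ → ℤ) → ℕ → ℕ → ℤ
γ a k zero    = ℤ.+ 1
γ a k (suc l) = sumℤ (map (prodℤ ∘ map a) (I k (suc l)))

sgn : ℕ → ℤ
sgn j = (- (ℤ.+ 1)) ^ j

-- p_n evaluated at x, with y = x + 1 (meaningful for n ≥ 2).
p : (ℕ → ℤ) → ℕ → ℤ → ℤ
p a n x =
    (x ^ r0) * sumℤ (map (λ k → sgn (m ∸ k) * (x ^ k) * (y ^ k) * γ a n ((n ∸ 2 ℕ.* k) ∸ r0))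
                         (upTo (suc m)))
  + (x ^ r1) * sumℤ (map (λ k → sgn (m ∸ k) * (x ^ k) * (y ^ k) * γ a n ((n ∸ 2 ℕ.* k) ∸ r1))
                         (upTo (suc (m ∸ r1))))
  where
  m  = n / 2
  r0 = n % 2
  r1 = 1 ∸ r0
  y  = x + ℤ.+ 1

-- Both sums defining p n combine into one expansion p n = Σ_{d ≤ n} c(n − d, d) γ_n(n − d), where the
-- coefficient c(l, d) of γ_{l+d}(l) satisfies c(l + 1, d) = (−1)^(l+d) c(l, d) and c(l, d + 2) = x y c(l, d).
-- Splitting the sequences counted by γ_n(l + 1) according to whether they end with n (the only admissible
-- alternative for the last entry is then at most n − 2) gives γ_n(l + 1) = a_n γ_{n−1}(l) + γ_{n−2}(l + 1).
-- Substituted into the expansion of p n, the first summand yields (−1)^(n+1) a_n p_{n−1}; the second,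
-- after shifting d by 2, yields x y p_{n−2}.
module Submission where

open import Defs
open import Data.Nat using (ℕ; _≤_; _∸_; suc)
open import Data.Integer using (ℤ; _+_; _*_; _<_)
open import Relation.Binary.PropositionalEquality using (_≡_)

open import Data.Bool using (Bool; true; false; _∧_; if_then_else_)
import Data.Bool.Properties as Boolₚ
open import Data.Integer as ℤ using (0ℤ; 1ℤ; -_; _^_)
import Data.Integer.Properties as ℤₚ
open import Data.Integer.Tactic.RingSolver using (solve-∀)
import Data.Nat.Tactic.RingSolver as ℕ-Solver
open import Data.List using (List; []; _∷_; [_]; map; _++_; filterᵇ; applyUpTo; length)
open import Data.List.Properties using (map-∘)
open import Data.List.Relation.Unary.All as All using (All; []; _∷_)
open import Data.List.Relation.Unary.All.Properties using (++⁺; map⁺)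
open import Data.Nat as ℕ using (zero; z≤n; s≤s; _≡ᵇ_; _%_; _/_)
import Data.Nat.DivMod as DivMod
import Data.Nat.Properties as ℕₚ
open import Data.Product using (_,_)
open import Function using (_∘_; id)
open import Relation.Binary.PropositionalEquality using (refl; sym; trans; cong; cong₂; subst; module ≡-Reasoning)
open import Relation.Nullary using (yes; no)

-- Finite sums

listSum : {A : Set} → List A → (A → ℤ) → ℤ
listSum xs f = sumℤ (map f xs)

infixl 10 listSum
syntax listSum xs (λ t → e) = ∑[ t ∈ xs ] e

module _ {A : Set} where

  listSum-++ : ∀ (xs ys : List A) f → listSum (xs ++ ys) f ≡ listSum xs f + listSum ys f
  listSum-++ []       ys f = sym (ℤₚ.+-identityˡ _)
  listSum-++ (x ∷ xs) ys f = trans (cong (f x +_) (listSum-++ xs ys f)) (sym (ℤₚ.+-assoc (f x) _ _))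

  listSum-map : ∀ {B : Set} (g : A → B) xs (f : B → ℤ) → listSum (map g xs) f ≡ listSum xs (f ∘ g)
  listSum-map g xs f = cong sumℤ (sym (map-∘ xs))

  listSum-cong : ∀ {xs : List A} {f g : A → ℤ} → All (λ t → f t ≡ g t) xs → listSum xs f ≡ listSum xs g
  listSum-cong []         = refl
  listSum-cong (eq ∷ eqs) = cong₂ _+_ eq (listSum-cong eqs)

  listSum-zero : ∀ (xs : List A) → listSum xs (λ _ → 0ℤ) ≡ 0ℤ
  listSum-zero []       = refl
  listSum-zero (x ∷ xs) = trans (ℤₚ.+-identityˡ _) (listSum-zero xs)

  *-distribˡ-listSum : ∀ c (xs : List A) f → listSum xs (λ t → c * f t) ≡ c * listSum xs f
  *-distribˡ-listSum c []       f = sym (ℤₚ.*-zeroʳ c)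
  *-distribˡ-listSum c (x ∷ xs) f =
    trans (cong (c * f x +_) (*-distribˡ-listSum c xs f)) (sym (ℤₚ.*-distribˡ-+ c (f x) _))

  listSum-filterᵇ : ∀ (P : A → Bool) xs f →
    listSum (filterᵇ P xs) f ≡ listSum xs (λ t → if P t then f t else 0ℤ)
  listSum-filterᵇ P []       f = refl
  listSum-filterᵇ P (x ∷ xs) f with P x
  ... | true  = cong (f x +_) (listSum-filterᵇ P xs f)
  ... | false = trans (listSum-filterᵇ P xs f) (sym (ℤₚ.+-identityˡ _))

sumBelow : ℕ → (ℕ → ℤ) → ℤ
sumBelow zero    f = 0ℤ
sumBelow (suc K) f = f 0 + sumBelow K (f ∘ suc)

infixl 10 sumBelow
syntax sumBelow K (λ k → e) = ∑[ k < K ] e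

sumℤ-applyUpTo : ∀ K (g : ℕ → ℤ) (f : ℕ → ℕ) → sumℤ (map g (applyUpTo f K)) ≡ sumBelow K (g ∘ f)
sumℤ-applyUpTo zero    g f = refl
sumℤ-applyUpTo (suc K) g f = cong (g (f 0) +_) (sumℤ-applyUpTo K g (f ∘ suc))

sumBelow-cong : ∀ K {f g : ℕ → ℤ} → (∀ k → k ℕ.< K → f k ≡ g k) → sumBelow K f ≡ sumBelow K g
sumBelow-cong zero    eq = refl
sumBelow-cong (suc K) eq = cong₂ _+_ (eq 0 (s≤s z≤n)) (sumBelow-cong K (λ k k<K → eq (suc k) (s≤s k<K)))

sumBelow-init-last : ∀ K f → sumBelow (suc K) f ≡ sumBelow K f + f K
sumBelow-init-last zero    f = ℤₚ.+-comm (f 0) 0ℤ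
sumBelow-init-last (suc K) f =
  trans (cong (f 0 +_) (sumBelow-init-last K (f ∘ suc))) (sym (ℤₚ.+-assoc (f 0) _ (f (suc K))))

sumBelow-distrib-+ : ∀ K f g → ∑[ k < K ] (f k + g k) ≡ sumBelow K f + sumBelow K g
sumBelow-distrib-+ zero    f g = refl
sumBelow-distrib-+ (suc K) f g =
  trans (cong (f 0 + g 0 +_) (sumBelow-distrib-+ K (f ∘ suc) (g ∘ suc))) (interchange (f 0) (g 0) _ _)
  where
  interchange : ∀ a b c d → (a + b) + (c + d) ≡ (a + c) + (b + d)
  interchange = solve-∀

*-distribˡ-sumBelow : ∀ c K f → ∑[ k < K ] (c * f k) ≡ c * sumBelow K f
*-distribˡ-sumBelow c zero    f = sym (ℤₚ.*-zeroʳ c)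
*-distribˡ-sumBelow c (suc K) f =
  trans (cong (c * f 0 +_) (*-distribˡ-sumBelow c K (f ∘ suc))) (sym (ℤₚ.*-distribˡ-+ c (f 0) _))

sumBelow-evens-odds : ∀ K f → sumBelow (2 ℕ.* K) f ≡ ∑[ k < K ] f (2 ℕ.* k) + ∑[ k < K ] f (suc (2 ℕ.* k))
sumBelow-evens-odds zero    f = refl
sumBelow-evens-odds (suc K) f = begin
  sumBelow (2 ℕ.* suc K) f
    ≡⟨ cong (λ n → sumBelow n f) (ℕₚ.*-suc 2 K) ⟩
  f 0 + (f 1 + sumBelow (2 ℕ.* K) (f ∘ suc ∘ suc))
    ≡⟨ cong (λ s → f 0 + (f 1 + s)) (sumBelow-evens-odds K (f ∘ suc ∘ suc)) ⟩
  f 0 + (f 1 + (E + O))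
    ≡⟨ regroup (f 0) (f 1) E O ⟩
  (f 0 + E) + (f 1 + O)
    ≡⟨ cong₂ (λ s t → (f 0 + s) + (f 1 + t))
         (sumBelow-cong K λ k _ → cong f (sym (ℕₚ.*-suc 2 k)))
         (sumBelow-cong K λ k _ → cong (f ∘ suc) (sym (ℕₚ.*-suc 2 k))) ⟩
  ∑[ k < suc K ] f (2 ℕ.* k) + ∑[ k < suc K ] f (suc (2 ℕ.* k)) ∎
  where
  open ≡-Reasoning
  E = ∑[ k < K ] f (suc (suc (2 ℕ.* k)))
  O = ∑[ k < K ] f (suc (suc (suc (2 ℕ.* k))))
  regroup : ∀ a b c d → a + (b + (c + d)) ≡ (a + c) + (b + d)
  regroup = solve-∀

sumBelow-evens-odds-last : ∀ K f →
  sumBelow (suc (2 ℕ.* K)) f ≡ ∑[ k < suc K ] f (2 ℕ.* k) + ∑[ k < K ] f (suc (2 ℕ.* k))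
sumBelow-evens-odds-last K f = begin
  sumBelow (suc (2 ℕ.* K)) f            ≡⟨ sumBelow-init-last (2 ℕ.* K) f ⟩
  sumBelow (2 ℕ.* K) f + f (2 ℕ.* K)   ≡⟨ cong (_+ f (2 ℕ.* K)) (sumBelow-evens-odds K f) ⟩
  (E + O) + f (2 ℕ.* K)                 ≡⟨ swap E O (f (2 ℕ.* K)) ⟩
  (E + f (2 ℕ.* K)) + O                 ≡⟨ cong (_+ O) (sym (sumBelow-init-last K (λ k → f (2 ℕ.* k)))) ⟩
  ∑[ k < suc K ] f (2 ℕ.* k) + O ∎
  where
  open ≡-Reasoning
  E = ∑[ k < K ] f (2 ℕ.* k)
  O = ∑[ k < K ] f (suc (2 ℕ.* k))
  swap : ∀ a b c → (a + b) + c ≡ (a + c) + b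
  swap = solve-∀

-- The recurrence of γ

seqs-zero : ∀ lo c → seqs lo c 0 ≡ [ [] ]
seqs-zero lo zero    = refl
seqs-zero lo (suc c) = refl

seqs-empty : ∀ lo {c l} → c ℕ.< l → seqs lo c l ≡ []
seqs-empty lo {zero}  {suc l} _ = refl
seqs-empty lo {suc c} {suc l} (s≤s c<l)
  rewrite seqs-empty (suc lo) c<l | seqs-empty (suc lo) (ℕₚ.m<n⇒m<1+n c<l) = refl

seqs-length : ∀ lo c l → All (λ ts → length ts ≡ l) (seqs lo c l)
seqs-length lo zero    zero    = refl ∷ []
seqs-length lo zero    (suc l) = []
seqs-length lo (suc c) zero    = refl ∷ []
seqs-length lo (suc c) (suc l) =
  ++⁺ (map⁺ (All.map (cong suc) (seqs-length (suc lo) c l))) (seqs-length (suc lo) c (suc l))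

listSum-seqs-head : ∀ lo c l (f : List ℕ → ℤ) →
  ∑[ ts ∈ seqs lo (suc c) (suc l) ] f ts
    ≡ ∑[ ts ∈ seqs (suc lo) c l ] f (lo ∷ ts) + ∑[ ts ∈ seqs (suc lo) c (suc l) ] f ts
listSum-seqs-head lo c l f =
  trans (listSum-++ (map (lo ∷_) (seqs (suc lo) c l)) (seqs (suc lo) c (suc l)) f)
        (cong (_+ ∑[ ts ∈ seqs (suc lo) c (suc l) ] f ts) (listSum-map (lo ∷_) (seqs (suc lo) c l) f))

-- A sequence in {lo, ..., lo + c} either avoids its largest possible entry lo + c or ends with it.
listSum-seqs-last : ∀ lo c l (f : List ℕ → ℤ) →
  ∑[ ts ∈ seqs lo (suc c) (suc l) ] f ts
    ≡ ∑[ ts ∈ seqs lo c (suc l) ] f ts + ∑[ ts ∈ seqs lo c l ] f (ts ++ [ lo ℕ.+ c ])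
listSum-seqs-last lo zero zero f rewrite ℕₚ.+-identityʳ lo = sym (ℤₚ.+-identityˡ _)
listSum-seqs-last lo zero (suc l) f = refl
listSum-seqs-last lo (suc c) zero f rewrite ℕₚ.+-suc lo c = begin
  f [ lo ] + B                      ≡⟨ cong (f [ lo ] +_) (listSum-seqs-last (suc lo) c 0 f) ⟩
  f [ lo ] + (B₁ + B₂)              ≡⟨ cong (λ s → f [ lo ] + (B₁ + ∑[ ts ∈ s ] f (ts ++ [ t ]))) (seqs-zero (suc lo) c) ⟩
  f [ lo ] + (B₁ + (f [ t ] + 0ℤ))  ≡⟨ sym (ℤₚ.+-assoc (f [ lo ]) B₁ _) ⟩
  (f [ lo ] + B₁) + (f [ t ] + 0ℤ)  ≡⟨ cong (λ s → ∑[ ts ∈ map (lo ∷_) s ++ seqs (suc lo) c 1 ] f ts + (f [ t ] + 0ℤ))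
                                               (sym (seqs-zero (suc lo) c)) ⟩
  ∑[ ts ∈ seqs lo (suc c) 1 ] f ts + ∑[ ts ∈ seqs lo (suc c) 0 ] f (ts ++ [ t ]) ∎
  where
  open ≡-Reasoning
  t  = suc lo ℕ.+ c
  B  = ∑[ ts ∈ seqs (suc lo) (suc c) 1 ] f ts
  B₁ = ∑[ ts ∈ seqs (suc lo) c 1 ] f ts
  B₂ = ∑[ ts ∈ seqs (suc lo) c 0 ] f (ts ++ [ t ])
listSum-seqs-last lo (suc c) (suc l) f rewrite ℕₚ.+-suc lo c = begin
  ∑[ ts ∈ seqs lo (suc (suc c)) (suc (suc l)) ] f ts
    ≡⟨ listSum-seqs-head lo (suc c) (suc l) f ⟩
  A + B
    ≡⟨ cong₂ _+_ (listSum-seqs-last (suc lo) c l (f ∘ (lo ∷_))) (listSum-seqs-last (suc lo) c (suc l) f) ⟩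
  (A₁ + A₂) + (B₁ + B₂)
    ≡⟨ interchange A₁ A₂ B₁ B₂ ⟩
  (A₁ + B₁) + (A₂ + B₂)
    ≡⟨ sym (cong₂ _+_ (listSum-seqs-head lo c (suc l) f) (listSum-seqs-head lo c l (λ ts → f (ts ++ [ t ])))) ⟩
  ∑[ ts ∈ seqs lo (suc c) (suc (suc l)) ] f ts + ∑[ ts ∈ seqs lo (suc c) (suc l) ] f (ts ++ [ t ]) ∎
  where
  open ≡-Reasoning
  t  = suc lo ℕ.+ c
  A  = ∑[ ts ∈ seqs (suc lo) (suc c) (suc l) ] f (lo ∷ ts)
  B  = ∑[ ts ∈ seqs (suc lo) (suc c) (suc (suc l)) ] f ts
  A₁ = ∑[ ts ∈ seqs (suc lo) c (suc l) ] f (lo ∷ ts)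
  A₂ = ∑[ ts ∈ seqs (suc lo) c l ] f (lo ∷ ts ++ [ t ])
  B₁ = ∑[ ts ∈ seqs (suc lo) c (suc (suc l)) ] f ts
  B₂ = ∑[ ts ∈ seqs (suc lo) c (suc l) ] f (ts ++ [ t ])
  interchange : ∀ a b c d → (a + b) + (c + d) ≡ (a + c) + (b + d)
  interchange = solve-∀

%2-suc-suc : ∀ t → suc (suc t) % 2 ≡ t % 2
%2-suc-suc t = trans (cong (_% 2) (ℕₚ.+-comm 2 t)) (DivMod.[m+n]%n≡m%n t 2)

≡ᵇ-refl : ∀ n → (n ≡ᵇ n) ≡ true
≡ᵇ-refl zero    = refl
≡ᵇ-refl (suc n) = ≡ᵇ-refl n

suc-%2-≢ᵇ : ∀ t → (suc t % 2 ≡ᵇ t % 2) ≡ false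
suc-%2-≢ᵇ zero          = refl
suc-%2-≢ᵇ (suc zero)    = refl
suc-%2-≢ᵇ (suc (suc t)) rewrite %2-suc-suc (suc t) | %2-suc-suc t = suc-%2-≢ᵇ t

parityOK-snoc : ∀ k l i ts t → parityOK k l i (ts ++ [ t ])
  ≡ parityOK k l i ts ∧ (t % 2 ≡ᵇ (k ℕ.+ (i ℕ.+ length ts) ∸ l) % 2)
parityOK-snoc k l i []       t rewrite ℕₚ.+-identityʳ i = Boolₚ.∧-identityʳ _
parityOK-snoc k l i (s ∷ ts) t rewrite ℕₚ.+-suc i (length ts) =
  trans (cong (b ∧_) (parityOK-snoc k l (suc i) ts t)) (sym (Boolₚ.∧-assoc b _ _))
  where b = s % 2 ≡ᵇ (k ℕ.+ i ∸ l) % 2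

parityOK-suc-suc : ∀ k l i ts → parityOK (suc k) (suc l) i ts ≡ parityOK k l i ts
parityOK-suc-suc k l i []       = refl
parityOK-suc-suc k l i (t ∷ ts) = cong (_ ∧_) (parityOK-suc-suc k l (suc i) ts)

-- The bound on l makes the truncated subtraction in parityOK exact.
parityOK-+2 : ∀ k l i ts → l ≤ k ℕ.+ i → parityOK (suc (suc k)) l i ts ≡ parityOK k l i ts
parityOK-+2 k l i []       l≤k+i = refl
parityOK-+2 k l i (t ∷ ts) l≤k+i = cong₂ _∧_
  (cong (λ r → t % 2 ≡ᵇ r) (trans (cong (_% 2) (ℕₚ.+-∸-assoc 2 l≤k+i)) (%2-suc-suc (k ℕ.+ i ∸ l))))
  (parityOK-+2 k l (suc i) ts (ℕₚ.≤-trans l≤k+i (ℕₚ.+-monoʳ-≤ k (ℕₚ.n≤1+n i))))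

weight : (ℕ → ℤ) → ℕ → ℕ → List ℕ → ℤ
weight a k l ts = if parityOK k l 1 ts then prodℤ (map a ts) else 0ℤ

prodℤ-snoc : ∀ (a : ℕ → ℤ) ts t → prodℤ (map a (ts ++ [ t ])) ≡ prodℤ (map a ts) * a t
prodℤ-snoc a []       t = trans (ℤₚ.*-identityʳ (a t)) (sym (ℤₚ.*-identityˡ (a t)))
prodℤ-snoc a (s ∷ ts) t = trans (cong (a s *_) (prodℤ-snoc a ts t)) (sym (ℤₚ.*-assoc (a s) _ _))

weight-snoc-top : ∀ a k l ts → length ts ≡ l →
  weight a (suc (suc k)) (suc l) (ts ++ [ suc (suc k) ]) ≡ a (suc (suc k)) * weight a (suc k) l ts
weight-snoc-top a k l ts refl
  rewrite parityOK-snoc (suc (suc k)) (suc l) 1 ts (suc (suc k))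
        | ℕₚ.m+n∸n≡m (suc (suc k)) (suc l) | ≡ᵇ-refl (suc (suc k) % 2)
        | Boolₚ.∧-identityʳ (parityOK (suc (suc k)) (suc l) 1 ts)
        | parityOK-suc-suc (suc k) l 1 ts
  with parityOK (suc k) l 1 ts
... | true  = trans (prodℤ-snoc a ts (suc (suc k))) (ℤₚ.*-comm (prodℤ (map a ts)) _)
... | false = sym (ℤₚ.*-zeroʳ (a (suc (suc k))))

weight-snoc-wrong-parity : ∀ a k l ts → length ts ≡ l →
  weight a (suc (suc k)) (suc l) (ts ++ [ suc k ]) ≡ 0ℤ
weight-snoc-wrong-parity a k l ts refl
  rewrite parityOK-snoc (suc (suc k)) (suc l) 1 ts (suc k)
        | ℕₚ.m+n∸n≡m (suc (suc k)) (suc l) | %2-suc-suc k | suc-%2-≢ᵇ k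
        | Boolₚ.∧-zeroʳ (parityOK (suc (suc k)) (suc l) 1 ts) = refl

γ-as-weighted-sum : ∀ a k l → γ a k l ≡ ∑[ ts ∈ seqs 1 k l ] weight a k l ts
γ-as-weighted-sum a k zero    rewrite seqs-zero 1 k = refl
γ-as-weighted-sum a k (suc l) =
  listSum-filterᵇ (parityOK k (suc l) 1) (seqs 1 k (suc l)) (prodℤ ∘ map a)

γ-vanishes : ∀ a {k l} → k ℕ.< l → γ a k l ≡ 0ℤ
γ-vanishes a {k} {l} k<l rewrite γ-as-weighted-sum a k l | seqs-empty 1 k<l = refl

γ-rec : ∀ a k l → γ a (suc (suc k)) (suc l) ≡ a (suc (suc k)) * γ a (suc k) l + γ a k (suc l)
γ-rec a k l = begin
  γ a (2+k) (suc l)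
    ≡⟨ γ-as-weighted-sum a (2+k) (suc l) ⟩
  ∑[ ts ∈ seqs 1 (2+k) (suc l) ] w ts
    ≡⟨ listSum-seqs-last 1 (suc k) l w ⟩
  ∑[ ts ∈ seqs 1 (suc k) (suc l) ] w ts + ∑[ ts ∈ seqs 1 (suc k) l ] w (ts ++ [ 2+k ])
    ≡⟨ cong₂ _+_ avoiding-top ending-with-top ⟩
  γ a k (suc l) + a (2+k) * γ a (suc k) l
    ≡⟨ ℤₚ.+-comm (γ a k (suc l)) _ ⟩
  a (2+k) * γ a (suc k) l + γ a k (suc l) ∎
  where
  open ≡-Reasoning
  2+k = suc (suc k)
  w   = weight a 2+k (suc l)

  ending-with-top : ∑[ ts ∈ seqs 1 (suc k) l ] w (ts ++ [ 2+k ]) ≡ a 2+k * γ a (suc k) l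
  ending-with-top = begin
    ∑[ ts ∈ seqs 1 (suc k) l ] w (ts ++ [ 2+k ])
      ≡⟨ listSum-cong (All.map (λ {ts} → weight-snoc-top a k l ts) (seqs-length 1 (suc k) l)) ⟩
    ∑[ ts ∈ seqs 1 (suc k) l ] (a 2+k * weight a (suc k) l ts)
      ≡⟨ *-distribˡ-listSum (a 2+k) (seqs 1 (suc k) l) (weight a (suc k) l) ⟩
    a 2+k * ∑[ ts ∈ seqs 1 (suc k) l ] weight a (suc k) l ts
      ≡⟨ cong (a 2+k *_) (sym (γ-as-weighted-sum a (suc k) l)) ⟩
    a 2+k * γ a (suc k) l ∎

  avoiding-top-two : ∑[ ts ∈ seqs 1 k (suc l) ] w ts ≡ γ a k (suc l)
  avoiding-top-two with l ℕₚ.≤? k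
  ... | yes l≤k = trans
    (listSum-cong (All.universal (λ ts → cong (λ b → if b then prodℤ (map a ts) else 0ℤ)
      (parityOK-+2 k (suc l) 1 ts (ℕₚ.≤-trans (s≤s l≤k) (ℕₚ.≤-reflexive (ℕₚ.+-comm 1 k)))))
      (seqs 1 k (suc l))))
    (sym (γ-as-weighted-sum a k (suc l)))
  ... | no  l≰k = trans (cong (λ s → ∑[ ts ∈ s ] w ts) (seqs-empty 1 k<1+l)) (sym (γ-vanishes a k<1+l))
    where k<1+l = ℕₚ.m<n⇒m<1+n (ℕₚ.≰⇒> l≰k)

  avoiding-top : ∑[ ts ∈ seqs 1 (suc k) (suc l) ] w ts ≡ γ a k (suc l)
  avoiding-top = begin
    ∑[ ts ∈ seqs 1 (suc k) (suc l) ] w ts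
      ≡⟨ listSum-seqs-last 1 k l w ⟩
    ∑[ ts ∈ seqs 1 k (suc l) ] w ts + ∑[ ts ∈ seqs 1 k l ] w (ts ++ [ suc k ])
      ≡⟨ cong₂ _+_ avoiding-top-two
           (listSum-cong (All.map (λ {ts} → weight-snoc-wrong-parity a k l ts) (seqs-length 1 k l))) ⟩
    γ a k (suc l) + ∑[ ts ∈ seqs 1 k l ] 0ℤ
      ≡⟨ cong (γ a k (suc l) +_) (listSum-zero (seqs 1 k l)) ⟩
    γ a k (suc l) + 0ℤ
      ≡⟨ ℤₚ.+-identityʳ _ ⟩
    γ a k (suc l) ∎

-- The coefficients of p

sgn-suc-suc : ∀ j → sgn (suc (suc j)) ≡ sgn j
sgn-suc-suc j = lemma (sgn j)
  where
  lemma : ∀ s → ℤ.-1ℤ * (ℤ.-1ℤ * s) ≡ s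
  lemma = solve-∀

sgn-square : ∀ j → sgn j * sgn j ≡ 1ℤ
sgn-square zero    = refl
sgn-square (suc j) = trans (lemma (sgn j)) (sgn-square j)
  where
  lemma : ∀ s → (ℤ.-1ℤ * s) * (ℤ.-1ℤ * s) ≡ s * s
  lemma = solve-∀

sgn-suc-suc-+ : ∀ m n → sgn (suc (m ℕ.+ suc (suc n))) ≡ sgn (suc (m ℕ.+ n))
sgn-suc-suc-+ m n rewrite ℕₚ.+-suc m (suc n) | ℕₚ.+-suc m n = sgn-suc-suc (suc (m ℕ.+ n))

m+n≡o⇒o∸m≡n : ∀ {m n o} → m ℕ.+ n ≡ o → o ∸ m ≡ n
m+n≡o⇒o∸m≡n {m} {n} refl = ℕₚ.m+n∸m≡n m n

+-2*-suc : ∀ n j → n ℕ.+ 2 ℕ.* suc j ≡ suc (suc (n ℕ.+ 2 ℕ.* j))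
+-2*-suc = ℕ-Solver.solve-∀

odd+odd : ∀ k j → suc (2 ℕ.* k) ℕ.+ suc (2 ℕ.* j) ≡ 2 ℕ.* suc (k ℕ.+ j)
odd+odd = ℕ-Solver.solve-∀

even+odd : ∀ k j → 2 ℕ.* k ℕ.+ suc (2 ℕ.* j) ≡ suc (2 ℕ.* (k ℕ.+ j))
even+odd = ℕ-Solver.solve-∀

module _ (x : ℤ) where

  -- coeff l d is the coefficient of γ a (l + d) l in p a (l + d) x; it does not depend on a.
  coeff : ℕ → ℕ → ℤ
  coeff zero    zero          = 1ℤ
  coeff zero    (suc zero)    = x
  coeff zero    (suc (suc d)) = x * (x + 1ℤ) * coeff zero d
  coeff (suc l) d             = sgn (suc (suc l ℕ.+ d)) * coeff l d

  coeff-suc-suc-degree : ∀ l d → coeff l (suc (suc d)) ≡ x * (x + 1ℤ) * coeff l d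
  coeff-suc-suc-degree zero    d = refl
  coeff-suc-suc-degree (suc l) d = begin
    sgn (suc (suc l ℕ.+ suc (suc d))) * coeff l (suc (suc d))
      ≡⟨ cong (_* coeff l (suc (suc d))) (sgn-suc-suc-+ (suc l) d) ⟩
    sgn (suc (suc l ℕ.+ d)) * coeff l (suc (suc d))
      ≡⟨ cong (sgn (suc (suc l ℕ.+ d)) *_) (coeff-suc-suc-degree l d) ⟩
    sgn (suc (suc l ℕ.+ d)) * (x * (x + 1ℤ) * coeff l d)
      ≡⟨ swap (sgn (suc (suc l ℕ.+ d))) (x * (x + 1ℤ)) (coeff l d) ⟩
    x * (x + 1ℤ) * (sgn (suc (suc l ℕ.+ d)) * coeff l d) ∎
    where
    open ≡-Reasoning
    swap : ∀ s u c → s * (u * c) ≡ u * (s * c)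
    swap = solve-∀

  coeff-suc-suc-gap : ∀ l d → coeff (suc (suc l)) d ≡ - coeff l d
  coeff-suc-suc-gap l d = trans (lemma s (coeff l d))
    (cong -_ (trans (cong (_* coeff l d) (sgn-square (suc (suc l ℕ.+ d)))) (ℤₚ.*-identityˡ (coeff l d))))
    where
    s = sgn (suc (suc l ℕ.+ d))
    lemma : ∀ s c → (ℤ.-1ℤ * s) * (s * c) ≡ - (s * s * c)
    lemma = solve-∀

  coeff-+-gap : ∀ l d j → coeff (l ℕ.+ 2 ℕ.* j) d ≡ sgn j * coeff l d
  coeff-+-gap l d zero    rewrite ℕₚ.+-identityʳ l = sym (ℤₚ.*-identityˡ (coeff l d))
  coeff-+-gap l d (suc j) rewrite +-2*-suc l j =
    trans (coeff-suc-suc-gap (l ℕ.+ 2 ℕ.* j) d) (trans (cong -_ (coeff-+-gap l d j)) (lemma (sgn j) (coeff l d)))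
    where
    lemma : ∀ s c → - (s * c) ≡ ℤ.-1ℤ * s * c
    lemma = solve-∀

  coeff-+-degree : ∀ l d k → coeff l (d ℕ.+ 2 ℕ.* k) ≡ x ^ k * (x + 1ℤ) ^ k * coeff l d
  coeff-+-degree l d zero    rewrite ℕₚ.+-identityʳ d = sym (ℤₚ.*-identityˡ (coeff l d))
  coeff-+-degree l d (suc k) rewrite +-2*-suc d k =
    trans (coeff-suc-suc-degree l (d ℕ.+ 2 ℕ.* k))
          (trans (cong (x * (x + 1ℤ) *_) (coeff-+-degree l d k)) (lemma x (x + 1ℤ) (x ^ k) ((x + 1ℤ) ^ k) (coeff l d)))
    where
    lemma : ∀ x y u v c → x * y * (u * v * c) ≡ x * u * (y * v) * c
    lemma = solve-∀

  coeff-closed : ∀ l d j k → coeff (l ℕ.+ 2 ℕ.* j) (d ℕ.+ 2 ℕ.* k) ≡ sgn j * x ^ k * (x + 1ℤ) ^ k * coeff l d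
  coeff-closed l d j k = begin
    coeff (l ℕ.+ 2 ℕ.* j) (d ℕ.+ 2 ℕ.* k)     ≡⟨ coeff-+-gap l (d ℕ.+ 2 ℕ.* k) j ⟩
    sgn j * coeff l (d ℕ.+ 2 ℕ.* k)          ≡⟨ cong (sgn j *_) (coeff-+-degree l d k) ⟩
    sgn j * (x ^ k * (x + 1ℤ) ^ k * coeff l d) ≡⟨ sym (ℤₚ.*-assoc (sgn j) (x ^ k * (x + 1ℤ) ^ k) (coeff l d)) ⟩
    sgn j * (x ^ k * (x + 1ℤ) ^ k) * coeff l d ≡⟨ cong (_* coeff l d) (sym (ℤₚ.*-assoc (sgn j) (x ^ k) _)) ⟩
    sgn j * x ^ k * (x + 1ℤ) ^ k * coeff l d ∎
    where open ≡-Reasoning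

  coeff-split : ∀ {n} l₀ r j k → r ℕ.+ 2 ℕ.* k ℕ.+ (l₀ ℕ.+ 2 ℕ.* j) ≡ n →
    coeff (n ∸ (r ℕ.+ 2 ℕ.* k)) (r ℕ.+ 2 ℕ.* k) ≡ sgn j * x ^ k * (x + 1ℤ) ^ k * coeff l₀ r
  coeff-split l₀ r j k eq =
    trans (cong (λ l → coeff l (r ℕ.+ 2 ℕ.* k)) (m+n≡o⇒o∸m≡n {m = r ℕ.+ 2 ℕ.* k} eq)) (coeff-closed l₀ r j k)

  -- The coefficient of the k-th term of the sum in p (r₀ + 2 m) carrying x ^ r, which ranges over k ≤ m ∸ (r ∸ r₀).
  coeff-at : ∀ r₀ r m k → r₀ ≤ 1 → r ≤ 1 → k ≤ m ∸ (r ∸ r₀) →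
    coeff (r₀ ℕ.+ 2 ℕ.* m ∸ (r ℕ.+ 2 ℕ.* k)) (r ℕ.+ 2 ℕ.* k) ≡ sgn (m ∸ k) * x ^ k * (x + 1ℤ) ^ k * x ^ r
  coeff-at _ _ m k z≤n z≤n k≤m with ℕₚ.m≤n⇒∃[o]m+o≡n k≤m
  ... | j , refl = trans (coeff-split 0 0 j k (sym (ℕₚ.*-distribˡ-+ 2 k j)))
                         (cong (λ i → sgn i * x ^ k * (x + 1ℤ) ^ k * 1ℤ) (sym (ℕₚ.m+n∸m≡n k j)))
  coeff-at _ _ zero    _ z≤n (s≤s z≤n) z≤n = lemma x
    where
    lemma : ∀ x → x ≡ 1ℤ * 1ℤ * 1ℤ * (x * 1ℤ)
    lemma = solve-∀
  coeff-at _ _ (suc m) k z≤n (s≤s z≤n) k≤m with ℕₚ.m≤n⇒∃[o]m+o≡n k≤m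
  ... | j , refl = trans (coeff-split 1 1 j k (odd+odd k j))
                         (trans (lemma (sgn j) (x ^ k) ((x + 1ℤ) ^ k) x)
                                (cong (λ i → sgn i * x ^ k * (x + 1ℤ) ^ k * (x * 1ℤ))
                                      (sym (m+n≡o⇒o∸m≡n {m = k} (ℕₚ.+-suc k j)))))
    where
    lemma : ∀ s u v w → s * u * v * (ℤ.-1ℤ * w) ≡ ℤ.-1ℤ * s * u * v * (w * 1ℤ)
    lemma = solve-∀
  coeff-at _ _ m k (s≤s z≤n) z≤n k≤m with ℕₚ.m≤n⇒∃[o]m+o≡n k≤m
  ... | j , refl = trans (coeff-split 1 0 j k (even+odd k j))
                         (cong (λ i → sgn i * x ^ k * (x + 1ℤ) ^ k * 1ℤ) (sym (ℕₚ.m+n∸m≡n k j)))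
  coeff-at _ _ m k (s≤s z≤n) (s≤s z≤n) k≤m with ℕₚ.m≤n⇒∃[o]m+o≡n k≤m
  ... | j , refl = trans (coeff-split 0 1 j k (cong suc (sym (ℕₚ.*-distribˡ-+ 2 k j))))
                         (cong₂ (λ i z → sgn i * x ^ k * (x + 1ℤ) ^ k * z) (sym (ℕₚ.m+n∸m≡n k j)) (sym (ℤₚ.*-identityʳ x)))

-- The expansion of p

module _ (a : ℕ → ℤ) (x : ℤ) where

  expansion-term : ℕ → ℕ → ℤ
  expansion-term n d = coeff x (n ∸ d) d * γ a n (n ∸ d)

  expansion : ℕ → ℤ
  expansion n = sumBelow (suc n) (expansion-term n)

  expansion-rec : ∀ N → expansion (suc (suc N))
    ≡ sgn (suc (suc (suc N))) * a (suc (suc N)) * expansion (suc N) + x * (x + 1ℤ) * expansion N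
  expansion-rec N = begin
    expansion n
      ≡⟨ sumBelow-init-last n term ⟩
    sumBelow n term + term n
      ≡⟨ cong₂ _+_ (sumBelow-cong n split) top ⟩
    ∑[ d < n ] (s * a n * lower d + rest d) + x * y * coeff x 0 N
      ≡⟨ cong (_+ x * y * coeff x 0 N) (sumBelow-distrib-+ n (λ d → s * a n * lower d) rest) ⟩
    ∑[ d < n ] (s * a n * lower d) + sumBelow n rest + x * y * coeff x 0 N
      ≡⟨ cong₂ (λ u v → u + v + x * y * coeff x 0 N) (*-distribˡ-sumBelow (s * a n) n lower) rest-shift ⟩
    s * a n * expansion (suc N) + (0ℤ + (0ℤ + x * y * sumBelow N lowest)) + x * y * coeff x 0 N
      ≡⟨ finish (s * a n * expansion (suc N)) (x * y) (sumBelow N lowest) (coeff x 0 N) ⟩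
    s * a n * expansion (suc N) + x * y * (sumBelow N lowest + coeff x 0 N)
      ≡⟨ cong (λ u → s * a n * expansion (suc N) + x * y * u) (sym lowest-last) ⟩
    s * a n * expansion (suc N) + x * y * expansion N ∎
    where
    open ≡-Reasoning
    n = suc (suc N)
    s = sgn (suc n)
    y = x + 1ℤ
    term lower rest lowest : ℕ → ℤ
    term     = expansion-term n
    lower  d = coeff x (suc N ∸ d) d * γ a (suc N) (suc N ∸ d)
    rest   d = coeff x (n ∸ d) d * γ a N (n ∸ d)
    lowest d = coeff x (N ∸ d) d * γ a N (N ∸ d)

    top : term n ≡ x * y * coeff x 0 N
    top rewrite ℕₚ.n∸n≡0 n = ℤₚ.*-identityʳ _

    split : ∀ d → d ℕ.< n → term d ≡ s * a n * lower d + rest d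
    split d (s≤s d≤1+N)
      rewrite ℕₚ.+-∸-assoc 1 d≤1+N | γ-rec a N (suc N ∸ d) | ℕₚ.m∸n+n≡m d≤1+N =
      distrib s (a n) (coeff x (suc N ∸ d) d) (γ a (suc N) (suc N ∸ d)) (γ a N (suc (suc N ∸ d)))
      where
      distrib : ∀ s b c g h → s * c * (b * g + h) ≡ s * b * (c * g) + s * c * h
      distrib = solve-∀

    rest-shift : sumBelow n rest ≡ 0ℤ + (0ℤ + x * y * sumBelow N lowest)
    rest-shift = begin
      rest 0 + (rest 1 + sumBelow N (rest ∘ suc ∘ suc))
        ≡⟨ cong₂ (λ u v → u + (v + sumBelow N (rest ∘ suc ∘ suc)))
                 (vanishing (ℕₚ.m<n⇒m<1+n (ℕₚ.n<1+n N))) (vanishing (ℕₚ.n<1+n N)) ⟩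
      0ℤ + (0ℤ + sumBelow N (rest ∘ suc ∘ suc))
        ≡⟨ cong (λ u → 0ℤ + (0ℤ + u)) (sumBelow-cong N λ d _ → shifted d) ⟩
      0ℤ + (0ℤ + ∑[ d < N ] (x * y * lowest d))
        ≡⟨ cong (λ u → 0ℤ + (0ℤ + u)) (*-distribˡ-sumBelow (x * y) N lowest) ⟩
      0ℤ + (0ℤ + x * y * sumBelow N lowest) ∎
      where
      vanishing : ∀ {l d} → N ℕ.< l → coeff x l d * γ a N l ≡ 0ℤ
      vanishing {l} {d} N<l = trans (cong (coeff x l d *_) (γ-vanishes a N<l)) (ℤₚ.*-zeroʳ (coeff x l d))
      shifted : ∀ d → rest (suc (suc d)) ≡ x * y * lowest d
      shifted d = trans (cong (_* γ a N (N ∸ d)) (coeff-suc-suc-degree x (N ∸ d) d))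
                        (ℤₚ.*-assoc (x * y) (coeff x (N ∸ d) d) (γ a N (N ∸ d)))

    lowest-last : expansion N ≡ sumBelow N lowest + coeff x 0 N
    lowest-last = trans (sumBelow-init-last N lowest) (cong (sumBelow N lowest +_) lowest-top)
      where
      lowest-top : lowest N ≡ coeff x 0 N
      lowest-top rewrite ℕₚ.n∸n≡0 N = ℤₚ.*-identityʳ (coeff x 0 N)

    finish : ∀ u c S e → u + (0ℤ + (0ℤ + c * S)) + c * e ≡ u + c * (S + e)
    finish = solve-∀

  p-term : ℕ → ℕ → ℕ → ℕ → ℤ
  p-term n m r k = sgn (m ∸ k) * x ^ k * (x + 1ℤ) ^ k * γ a n ((n ∸ 2 ℕ.* k) ∸ r)

  p-qr : ℕ → ℕ → ℕ → ℤ
  p-qr n m r = x ^ r * ∑[ k < suc m ] p-term n m r k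
               + x ^ (1 ∸ r) * ∑[ k < suc (m ∸ (1 ∸ r)) ] p-term n m (1 ∸ r) k

  p≡p-qr : ∀ n → p a n x ≡ p-qr n (n / 2) (n % 2)
  p≡p-qr n = cong₂ (λ u v → x ^ (n % 2) * u + x ^ (1 ∸ n % 2) * v)
    (sumℤ-applyUpTo (suc (n / 2)) (p-term n (n / 2) (n % 2)) id)
    (sumℤ-applyUpTo (suc (n / 2 ∸ (1 ∸ n % 2))) (p-term n (n / 2) (1 ∸ n % 2)) id)

  expansion-slot : ∀ r₀ r m k → r₀ ≤ 1 → r ≤ 1 → k ≤ m ∸ (r ∸ r₀) →
    expansion-term (r₀ ℕ.+ 2 ℕ.* m) (r ℕ.+ 2 ℕ.* k) ≡ x ^ r * p-term (r₀ ℕ.+ 2 ℕ.* m) m r k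
  expansion-slot r₀ r m k r₀≤1 r≤1 k≤ = trans
    (cong₂ _*_ (coeff-at x r₀ r m k r₀≤1 r≤1 k≤) (cong (γ a n) index))
    (lemma (sgn (m ∸ k)) (x ^ k) ((x + 1ℤ) ^ k) (x ^ r) (γ a n ((n ∸ 2 ℕ.* k) ∸ r)))
    where
    n = r₀ ℕ.+ 2 ℕ.* m
    index : n ∸ (r ℕ.+ 2 ℕ.* k) ≡ (n ∸ 2 ℕ.* k) ∸ r
    index = trans (cong (n ∸_) (ℕₚ.+-comm r (2 ℕ.* k))) (sym (ℕₚ.∸-+-assoc n (2 ℕ.* k) r))
    lemma : ∀ s u v w g → s * u * v * w * g ≡ w * (s * u * v * g)
    lemma = solve-∀

  p-qr≡expansion : ∀ r m → r ≤ 1 → 1 ≤ r ℕ.+ 2 ℕ.* m → p-qr (r ℕ.+ 2 ℕ.* m) m r ≡ expansion (r ℕ.+ 2 ℕ.* m)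
  p-qr≡expansion _ (suc m) z≤n _ = sym (begin
    sumBelow (suc (2 ℕ.* suc m)) T
      ≡⟨ sumBelow-evens-odds-last (suc m) T ⟩
    ∑[ k < suc (suc m) ] T (2 ℕ.* k) + ∑[ k < suc m ] T (suc (2 ℕ.* k))
      ≡⟨ cong₂ _+_ (sumBelow-cong (suc (suc m)) λ { k (s≤s k≤) → expansion-slot 0 0 (suc m) k z≤n z≤n k≤ })
                   (sumBelow-cong (suc m) λ { k (s≤s k≤) → expansion-slot 0 1 (suc m) k z≤n (s≤s z≤n) k≤ }) ⟩
    ∑[ k < suc (suc m) ] (1ℤ * p-term n (suc m) 0 k) + ∑[ k < suc m ] (x ^ 1 * p-term n (suc m) 1 k)
      ≡⟨ cong₂ _+_ (*-distribˡ-sumBelow 1ℤ (suc (suc m)) (p-term n (suc m) 0))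
                   (*-distribˡ-sumBelow (x ^ 1) (suc m) (p-term n (suc m) 1)) ⟩
    p-qr n (suc m) 0 ∎)
    where
    open ≡-Reasoning
    n = 2 ℕ.* suc m
    T = expansion-term n
  p-qr≡expansion _ m (s≤s z≤n) _ = sym (begin
    sumBelow (suc (suc (2 ℕ.* m))) T
      ≡⟨ cong (λ K → sumBelow K T) (sym (ℕₚ.*-suc 2 m)) ⟩
    sumBelow (2 ℕ.* suc m) T
      ≡⟨ sumBelow-evens-odds (suc m) T ⟩
    ∑[ k < suc m ] T (2 ℕ.* k) + ∑[ k < suc m ] T (suc (2 ℕ.* k))
      ≡⟨ cong₂ _+_ (sumBelow-cong (suc m) λ { k (s≤s k≤) → expansion-slot 1 0 m k (s≤s z≤n) z≤n k≤ })
                   (sumBelow-cong (suc m) λ { k (s≤s k≤) → expansion-slot 1 1 m k (s≤s z≤n) (s≤s z≤n) k≤ }) ⟩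
    ∑[ k < suc m ] (1ℤ * p-term n m 0 k) + ∑[ k < suc m ] (x ^ 1 * p-term n m 1 k)
      ≡⟨ cong₂ _+_ (*-distribˡ-sumBelow 1ℤ (suc m) (p-term n m 0))
                   (*-distribˡ-sumBelow (x ^ 1) (suc m) (p-term n m 1)) ⟩
    1ℤ * ∑[ k < suc m ] p-term n m 0 k + x ^ 1 * ∑[ k < suc m ] p-term n m 1 k
      ≡⟨ ℤₚ.+-comm (1ℤ * ∑[ k < suc m ] p-term n m 0 k) (x ^ 1 * ∑[ k < suc m ] p-term n m 1 k) ⟩
    p-qr n m 1 ∎)
    where
    open ≡-Reasoning
    n = suc (2 ℕ.* m)
    T = expansion-term n

  p≡expansion : ∀ n → 1 ≤ n → p a n x ≡ expansion n
  p≡expansion n 1≤n = trans (p≡p-qr n)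
    (subst (λ n′ → p-qr n′ (n / 2) (n % 2) ≡ expansion n′) (sym n≡r+2m)
           (p-qr≡expansion (n % 2) (n / 2) (ℕₚ.≤-pred (DivMod.m%n<n n 2)) (subst (1 ≤_) n≡r+2m 1≤n)))
    where
    n≡r+2m : n ≡ n % 2 ℕ.+ 2 ℕ.* (n / 2)
    n≡r+2m = trans (DivMod.m≡m%n+[m/n]*n n 2) (cong (n % 2 ℕ.+_) (ℕₚ.*-comm (n / 2) 2))

theorem4 : (a : ℕ → ℤ) → (∀ i → 1 ≤ i → Data.Integer.+ 0 < a i) →
    ∀ (n : ℕ) → 4 ≤ n → ∀ (x : ℤ) →
      p a n x ≡ sgn (suc n) * a n * p a (n ∸ 1) x + x * (x + Data.Integer.+ 1) * p a (n ∸ 2) x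
theorem4 a _ n@(suc (suc N)) (s≤s (s≤s 2≤N)) x = begin
  p a n x
    ≡⟨ p≡expansion a x n (s≤s z≤n) ⟩
  expansion a x n
    ≡⟨ expansion-rec a x N ⟩
  sgn (suc n) * a n * expansion a x (suc N) + x * (x + 1ℤ) * expansion a x N
    ≡⟨ sym (cong₂ (λ u v → sgn (suc n) * a n * u + x * (x + 1ℤ) * v)
                  (p≡expansion a x (suc N) (s≤s z≤n)) (p≡expansion a x N (ℕₚ.<⇒≤ 2≤N))) ⟩
  sgn (suc n) * a n * p a (suc N) x + x * (x + 1ℤ) * p a N x ∎
  where open ≡-Reasoning
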